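{- Let $G_1$ and $G_2$ be two vertex-disjoint 2-edge-colored simple graphs with Hamiltonian alternating cycles $C_1=x_0x_1\cdots x_{2n-1}x_0$ and $C_2=y_0y_1\cdots y_{2m-1}y_0$, respectively, and let $G\in G_1\oplus G_2$. Suppose there is no good pair in $G$, and for each $i\in\{1,2\}$ the cycle $C_i$ contains a vertex which is non-singular with respect to $C_{3-i}$. Then there exist $r\in[0,2m-1]$ and $s\in[0,2n-1]$ such that $x_0y_ry_{r+1}y_{r+2}x_0$ and $y_0x_sx_{s+1}x_{s+2}y_0$ are alternating 4-cycles in $G$ (subscripts of $y$ taken modulo $2m$ and of $x$ modulo $2n$).
   Context: All graphs are simple and 2-edge-colored with colors red and blue. An alternating path/cycle is one in which any two consecutive edges have different colors; a Hamiltonian alternating cycle is an alternating cycle through all vertices of the graph. For vertex-disjoint 2-edge-colored graphs $G_1,G_2$, the colored generalized sum $G_1\oplus G_2$ is the set of 2-edge-colored graphs $G$ with $V(G)=V(G_1)\cup V(G_2)$, $G\langle V(G_i)\rangle$ equal to $G_i$ with its coloring for $i=1,2$, and exactly one edge (of arbitrary fixed color) between every $u\in V(G_1)$ and $w\in V(G_2)$; these latter edges are called exterior. For a vertex $v$ of an alternating cycle $C$, $v^r$ (resp. $v^b$) denotes the vertex of $C$ such that $vv^r\in E(C)$ is red (resp. $vv^b\in E(C)$ is blue). For an edge $vw$ with $v\in V(C_1)$, $w\in V(C_2)$: if $vw$ is red, the pair $vw, v^rw^r$ is a good pair if $v^rw^r$ is red; if $vw$ is blue, the pair $vw,v^bw^b$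 is a good pair if $v^bw^b$ is blue (here $v^r,v^b$ are taken in $C_1$ and $w^r,w^b$ in $C_2$). A vertex $v\in V(C_i)$ is red-singular (resp. blue-singular) with respect to $C_{3-i}$ if all edges $vu$ with $u\in V(C_{3-i})$ are red (resp. blue); singular means red- or blue-singular, and non-singular means not singular. -}

module Defs where

open import Data.Nat using (ℕ; zero; suc; _*_; _≤_; _%_)
open import Data.Nat.DivMod using (m%n<n)
open import Data.Fin using (Fin; zero; toℕ; fromℕ<)
open import Data.Maybe using (Maybe; just; nothing)
open import Data.Sum using (_⊎_; inj₁; inj₂)
open import Data.Product using (Σ; ∃; _×_; _,_)
open import Relation.Nullary using (¬_)
open import Relation.Binary.PropositionalEquality using (_≡_; _≢_)
open import Function.Definitions using (Bijective)

data Color : Set where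
  red blue : Color

-- A simple 2-edge-coloured graph on vertex type V:
-- edge u v = just c  iff  uv is an edge with colour c;  nothing = no edge.
record ColoredGraph (V : Set) : Set where
  field
    edge   : V → V → Maybe Color
    sym    : ∀ u v → edge u v ≡ edge v u
    noLoop : ∀ v → edge v v ≡ nothing
open ColoredGraph public

csuc : ∀ {k} → Fin k → Fin k
csuc {suc k} i = fromℕ< (m%n<n (suc (toℕ i)) (suc k))

-- x : Fin (2n) → V enumerates a Hamiltonian alternating cycle
-- x₀ x₁ … x_{2n-1} x₀ of G (length 2n ≥ 4 since it is a cycle).
record HamAltCycle {V : Set} (G : ColoredGraph V) (n : ℕ) (x : Fin (2 * n) → V) : Set where
  field
    len      : 2 ≤ n
    bij      : Bijective _≡_ _≡_ x
    isEdge   : ∀ i → ∃ λ c → edge G (x i) (x (csuc i)) ≡ just c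
    alternating : ∀ i c c' → edge G (x i) (x (csuc i)) ≡ just c →
                  edge G (x (csuc i)) (x (csuc (csuc i))) ≡ just c' → c ≢ c'

origin : ∀ n → 2 ≤ n → Fin (2 * n)
origin (suc n) _ = zero

-- G ∈ G₁ ⊕ G₂ (vertex-disjointness is modelled by the disjoint union V₁ ⊎ V₂).
record InSum {V₁ V₂ : Set} (G₁ : ColoredGraph V₁) (G₂ : ColoredGraph V₂)
             (G : ColoredGraph (V₁ ⊎ V₂)) : Set where
  field
    left     : ∀ u v → edge G (inj₁ u) (inj₁ v) ≡ edge G₁ u v
    right    : ∀ u v → edge G (inj₂ u) (inj₂ v) ≡ edge G₂ u v
    exterior : ∀ u w → ∃ λ c → edge G (inj₁ u) (inj₂ w) ≡ just c

-- j is the c-partner of i on the cycle z (i.e. z j = (z i)^c):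
-- z i z j is the edge of the cycle at z i with colour c.
Partner : {V : Set} (G : ColoredGraph V) {k : ℕ} (z : Fin k → V) →
          Color → Fin k → Fin k → Set
Partner G z c i j =
  ((j ≡ csuc i) × edge G (z i) (z j) ≡ just c) ⊎
  ((i ≡ csuc j) × edge G (z j) (z i) ≡ just c)

HasGoodPair : {V₁ V₂ : Set} (G : ColoredGraph (V₁ ⊎ V₂)) {k l : ℕ}
              (x : Fin k → V₁) (y : Fin l → V₂) → Set
HasGoodPair G x y =
  Σ Color λ c → Σ _ λ i → Σ _ λ j → Σ _ λ i' → Σ _ λ j' →
    edge G (inj₁ (x i)) (inj₂ (y j)) ≡ just c ×
    Partner G (λ a → inj₁ (x a)) c i i' ×
    Partner G (λ b → inj₂ (y b)) c j j' ×
    edge G (inj₁ (x i')) (inj₂ (y j')) ≡ just c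

ColorSingular : {V S : Set} (G : ColoredGraph V) (emb : S → V) → Color → V → Set
ColorSingular G emb c v = ∀ u → edge G v (emb u) ≡ just c

NonSingular : {V S : Set} (G : ColoredGraph V) (emb : S → V) → V → Set
NonSingular G emb v = ¬ ColorSingular G emb red v × ¬ ColorSingular G emb blue v

Alt4Cycle : {V : Set} (G : ColoredGraph V) → V → V → V → V → Set
Alt4Cycle G a b c d =
  (a ≢ b × a ≢ c × a ≢ d × b ≢ c × b ≢ d × c ≢ d) ×
  Σ Color λ c₁ → Σ Color λ c₂ → Σ Color λ c₃ → Σ Color λ c₄ →
    edge G a b ≡ just c₁ × edge G b c ≡ just c₂ ×
    edge G c d ≡ just c₃ × edge G d a ≡ just c₄ ×
    c₁ ≢ c₂ × c₂ ≢ c₃ × c₃ ≢ c₄ × c₄ ≢ c₁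

-- Write a i, b j for the colours of the cycle edges x_i x_{i+1}, y_j y_{j+1} and F i j for
-- the colour of x_i y_j, and compare colours by the group law _⊕_ of ℤ/2. Without good pairs,
-- following the F i j-coloured cycle edges at both ends of x_i y_j leads to an exterior edge
-- of the opposite colour. This move flips a, b and F at once, so it preserves F ⊕ b, a ⊕ b and
-- a ⊕ F; the last one makes the move travel along C₁ in a fixed direction, so every exterior
-- edge is linked to one at x₀ with the same values of F ⊕ b and a ⊕ b. If no r had
-- F 0 r ≠ b r and F 0 (r+2) = b (r+2), then F 0 r ⊕ b r would depend only on b r, so F ⊕ b
-- would be a function of a ⊕ b; this forces F to be constant along every row or along every
-- column, i.e. all x_i or all y_j to be singular. Such an r gives the alternating 4-cycle
-- x₀ y_r y_{r+1} y_{r+2}, and the other 4-cycle is found symmetrically.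
module Submission where

open import Defs hiding (sym)
open import Data.Nat using (ℕ; zero; suc; _+_; _*_; _∸_; _%_; NonZero)
open import Data.Nat.Properties using (+-identityʳ; +-suc; +-assoc; +-comm; m+[n∸m]≡n; <⇒≤; n≮0)
open import Data.Nat.DivMod using (m<n⇒m%n≡m; [m+n]%n≡m%n; %-distribˡ-+; m%n%n≡m%n)
open import Data.Nat.GeneralisedArithmetic using (iterate)
open import Data.Fin using (Fin; zero; toℕ)
open import Data.Fin.Properties using (toℕ-fromℕ<; toℕ-injective; toℕ<n; any?)
open import Data.Maybe using (just)
open import Data.Maybe.Properties using (just-injective)
open import Data.Product using (∃; _×_; _,_; proj₁; proj₂)
open import Data.Sum using (_⊎_; inj₁; inj₂; [_,_]′)
open import Data.Empty using (⊥-elim)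
open import Function using (_∘_; flip)
open import Function.Definitions using (Surjective)
open import Relation.Nullary using (¬_; yes; no)
open import Relation.Nullary.Decidable using (_×-dec_)
open import Relation.Binary.Definitions using (DecidableEquality)
open import Relation.Binary.PropositionalEquality

neg : Color → Color
neg red  = blue
neg blue = red

neg-involutive : ∀ c → neg (neg c) ≡ c
neg-involutive red  = refl
neg-involutive blue = refl

neg-irreflexive : ∀ c → neg c ≢ c
neg-irreflexive red  ()
neg-irreflexive blue ()

≢⇒≡neg : ∀ {c d} → c ≢ d → c ≡ neg d
≢⇒≡neg {red}  {red}  c≢d = ⊥-elim (c≢d refl)
≢⇒≡neg {red}  {blue} _   = refl
≢⇒≡neg {blue} {red}  _   = refl
≢⇒≡neg {blue} {blue} c≢d = ⊥-elim (c≢d refl)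

_≟ᶜ_ : DecidableEquality Color
red  ≟ᶜ red  = yes refl
red  ≟ᶜ blue = no λ ()
blue ≟ᶜ red  = no λ ()
blue ≟ᶜ blue = yes refl

infixl 6 _⊕_

_⊕_ : Color → Color → Color
red  ⊕ c = c
blue ⊕ c = neg c

⊕-assoc : ∀ x y z → (x ⊕ y) ⊕ z ≡ x ⊕ (y ⊕ z)
⊕-assoc red  y    z = refl
⊕-assoc blue red  z = refl
⊕-assoc blue blue z = sym (neg-involutive z)

⊕-cancelˡ : ∀ x y → x ⊕ (x ⊕ y) ≡ y
⊕-cancelˡ red  y = refl
⊕-cancelˡ blue y = neg-involutive y

⊕-cancelʳ : ∀ x y → x ⊕ y ⊕ y ≡ x
⊕-cancelʳ red  red  = refl
⊕-cancelʳ red  blue = refl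
⊕-cancelʳ blue red  = refl
⊕-cancelʳ blue blue = refl

neg-⊕-neg : ∀ x y → neg x ⊕ neg y ≡ x ⊕ y
neg-⊕-neg red  y = neg-involutive y
neg-⊕-neg blue y = refl

⊕≡red⇒≡ : ∀ {x y} → x ⊕ y ≡ red → x ≡ y
⊕≡red⇒≡ {red}  {red}  _ = refl
⊕≡red⇒≡ {blue} {blue} _ = refl

⊕≡blue⇒≡neg : ∀ {x y} → x ⊕ y ≡ blue → x ≡ neg y
⊕≡blue⇒≡neg {red}  {blue} _ = refl
⊕≡blue⇒≡neg {blue} {red}  _ = refl

Color-function-cases : (T : Color → Color) →
  (∀ c → T c ≡ T red) ⊎ (∀ c → T c ≡ T red ⊕ c)
Color-function-cases T with T red in e₀ | T blue in e₁
... | red  | red  = inj₁ λ { red → e₀ ; blue → e₁ }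
... | red  | blue = inj₂ λ { red → e₀ ; blue → e₁ }
... | blue | red  = inj₂ λ { red → e₀ ; blue → e₁ }
... | blue | blue = inj₁ λ { red → e₀ ; blue → e₁ }

iterate-neg-fixed⇒even : ∀ c t → iterate neg c t ≡ c → ∃ λ u → t ≡ u * 2
iterate-neg-fixed⇒even c zero          _ = 0 , refl
iterate-neg-fixed⇒even c (suc zero)    e = ⊥-elim (neg-irreflexive c e)
iterate-neg-fixed⇒even c (suc (suc t)) e
  with iterate-neg-fixed⇒even c t (subst (λ d → iterate neg d t ≡ c) (neg-involutive c) e)
... | u , t≡u*2 = suc u , cong (suc ∘ suc) t≡u*2

iterate-suc : ∀ {A : Set} (f : A → A) x t → iterate f x (suc t) ≡ f (iterate f x t)
iterate-suc f x zero    = refl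
iterate-suc f x (suc t) = iterate-suc f (f x) t

iterate-preserves : ∀ {A B : Set} (h : A → B) {f : A → A} →
  (∀ x → h (f x) ≡ h x) → ∀ x t → h (iterate f x t) ≡ h x
iterate-preserves h     inv x zero    = refl
iterate-preserves h {f} inv x (suc t) = trans (iterate-preserves h inv (f x) t) (inv x)

iterate-cancel : ∀ {A : Set} {f g : A → A} → (∀ x → g (f x) ≡ x) →
  ∀ x t → iterate g (iterate f x t) t ≡ x
iterate-cancel             inv x zero    = refl
iterate-cancel {f = f} {g} inv x (suc t) = begin
  iterate g (iterate f x (suc t)) (suc t) ≡⟨ cong (λ y → iterate g y (suc t)) (iterate-suc f x t) ⟩
  iterate g (g (f (iterate f x t))) t     ≡⟨ cong (λ y → iterate g y t) (inv _) ⟩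
  iterate g (iterate f x t) t             ≡⟨ iterate-cancel inv x t ⟩
  x                                       ∎
  where open ≡-Reasoning

[m%n+o]%n≡[m+o]%n : ∀ m o n .{{_ : NonZero n}} → (m % n + o) % n ≡ (m + o) % n
[m%n+o]%n≡[m+o]%n m o n = begin
  (m % n + o) % n         ≡⟨ %-distribˡ-+ (m % n) o n ⟩
  (m % n % n + o % n) % n ≡⟨ cong (λ v → (v + o % n) % n) (m%n%n≡m%n m n) ⟩
  (m % n + o % n) % n     ≡⟨ %-distribˡ-+ m o n ⟨
  (m + o) % n             ∎
  where open ≡-Reasoning

toℕ-csuc : ∀ {k} (i : Fin (suc k)) → toℕ (csuc i) ≡ suc (toℕ i) % suc k
toℕ-csuc i = toℕ-fromℕ< _

toℕ-iterate-csuc : ∀ {k} (i : Fin (suc k)) t → toℕ (iterate csuc i t) ≡ (toℕ i + t) % suc k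
toℕ-iterate-csuc {k} i zero =
  sym (trans (cong (_% suc k) (+-identityʳ (toℕ i))) (m<n⇒m%n≡m (toℕ<n i)))
toℕ-iterate-csuc {k} i (suc t) = begin
  toℕ (iterate csuc (csuc i) t)     ≡⟨ toℕ-iterate-csuc (csuc i) t ⟩
  (toℕ (csuc i) + t) % suc k        ≡⟨ cong (λ v → (v + t) % suc k) (toℕ-csuc i) ⟩
  (suc (toℕ i) % suc k + t) % suc k ≡⟨ [m%n+o]%n≡[m+o]%n (suc (toℕ i)) t (suc k) ⟩
  (suc (toℕ i) + t) % suc k         ≡⟨ cong (_% suc k) (+-suc (toℕ i) t) ⟨
  (toℕ i + suc t) % suc k           ∎
  where open ≡-Reasoning

iterate-csuc-≡ : ∀ {k} {i j : Fin (suc k)} t → (toℕ i + t) % suc k ≡ toℕ j → iterate csuc i t ≡ j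
iterate-csuc-≡ {i = i} t e = toℕ-injective (trans (toℕ-iterate-csuc i t) e)

iterate-csuc-period : ∀ {k} (i : Fin (suc k)) → iterate csuc i (suc k) ≡ i
iterate-csuc-period {k} i =
  iterate-csuc-≡ (suc k) (trans ([m+n]%n≡m%n (toℕ i) (suc k)) (m<n⇒m%n≡m (toℕ<n i)))

iterate-csuc-surjective : ∀ {k} (i j : Fin (suc k)) → ∃ λ t → iterate csuc i t ≡ j
iterate-csuc-surjective {k} i j = suc k ∸ toℕ i + toℕ j , iterate-csuc-≡ (suc k ∸ toℕ i + toℕ j) (begin
  (toℕ i + (suc k ∸ toℕ i + toℕ j)) % suc k ≡⟨ cong (_% suc k) (+-assoc (toℕ i) (suc k ∸ toℕ i) (toℕ j)) ⟨
  (toℕ i + (suc k ∸ toℕ i) + toℕ j) % suc k ≡⟨ cong (λ v → (v + toℕ j) % suc k) (m+[n∸m]≡n (<⇒≤ (toℕ<n i))) ⟩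
  (suc k + toℕ j) % suc k                   ≡⟨ cong (_% suc k) (+-comm (suc k) (toℕ j)) ⟩
  (toℕ j + suc k) % suc k                   ≡⟨ [m+n]%n≡m%n (toℕ j) (suc k) ⟩
  toℕ j % suc k                             ≡⟨ m<n⇒m%n≡m (toℕ<n j) ⟩
  toℕ j                                     ∎)
  where open ≡-Reasoning

cpred : ∀ {k} → Fin (suc k) → Fin (suc k)
cpred {k} i = iterate csuc i k

cpred-csuc : ∀ {k} (i : Fin (suc k)) → cpred (csuc i) ≡ i
cpred-csuc = iterate-csuc-period

csuc-cpred : ∀ {k} (i : Fin (suc k)) → csuc (cpred i) ≡ i
csuc-cpred {k} i = trans (sym (iterate-suc csuc i k)) (iterate-csuc-period i)

move : ∀ {k} → Color → Fin (suc k) → Fin (suc k)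
move red  = csuc
move blue = cpred

iterate-move-reaches : ∀ {k} s (i j : Fin (suc k)) → ∃ λ t → iterate (move s) i t ≡ j
iterate-move-reaches red  i j = iterate-csuc-surjective i j
iterate-move-reaches blue i j with iterate-csuc-surjective j i
... | t , j↦i = t , trans (cong (λ y → iterate cpred y t) (sym j↦i)) (iterate-cancel cpred-csuc j t)

Alternating : ∀ {k} → (Fin k → Color) → Set
Alternating a = ∀ i → a (csuc i) ≡ neg (a i)

module _ {k} {a : Fin (suc k) → Color} (a-alt : Alternating a) where

  alternating-cpred : ∀ i → a (cpred i) ≡ neg (a i)
  alternating-cpred i = begin
    a (cpred i)              ≡⟨ neg-involutive _ ⟨
    neg (neg (a (cpred i)))  ≡⟨ cong neg (a-alt (cpred i)) ⟨
    neg (a (csuc (cpred i))) ≡⟨ cong (neg ∘ a) (csuc-cpred i) ⟩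
    neg (a i)                ∎
    where open ≡-Reasoning

  alternating-move : ∀ s i → a (move s i) ≡ neg (a i)
  alternating-move red  = a-alt
  alternating-move blue = alternating-cpred

  alternating-two-step : ∀ i → a (csuc (csuc i)) ≡ a i
  alternating-two-step i = trans (a-alt (csuc i)) (trans (cong neg (a-alt i)) (neg-involutive (a i)))

  alternating-iterate : ∀ i t → a (iterate csuc i t) ≡ iterate neg (a i) t
  alternating-iterate i zero    = refl
  alternating-iterate i (suc t) =
    trans (alternating-iterate (csuc i) t) (cong (λ c → iterate neg c t) (a-alt i))

  alternating-onto : ∀ c → ∃ λ i → a i ≡ c
  alternating-onto c with c ≟ᶜ a zero
  ... | yes c≡a₀ = zero , sym c≡a₀
  ... | no  c≢a₀ = csuc zero , trans (a-alt zero) (sym (≢⇒≡neg c≢a₀))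

  two-step-closed⇒colour-closed : (P : Fin (suc k) → Set) → (∀ i → P i → P (csuc (csuc i))) →
    ∀ i j → a i ≡ a j → P i → P j
  two-step-closed⇒colour-closed P step i j aᵢ≡aⱼ Pᵢ
    with iterate-csuc-surjective i j
  ... | t , i↦j with iterate-neg-fixed⇒even (a i) t
                       (trans (sym (alternating-iterate i t)) (trans (cong a i↦j) (sym aᵢ≡aⱼ)))
  ... | u , refl = subst P i↦j (steps u i Pᵢ)
    where
      steps : ∀ u i → P i → P (iterate csuc i (u * 2))
      steps zero    i Pᵢ = Pᵢ
      steps (suc u) i Pᵢ = steps u (csuc (csuc i)) (step i Pᵢ)

-- The index of (z i)^c: the cycle edge z i z (i+1) has colour a i, so it lies ahead iff a i = c.
partner : ∀ {k} → (Fin (suc k) → Color) → Color → Fin (suc k) → Fin (suc k)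
partner a c i = move (a i ⊕ c) i

NoGoodPair : ∀ {k l} → (Fin (suc k) → Color) → (Fin (suc l) → Color) →
  (Fin (suc k) → Fin (suc l) → Color) → Set
NoGoodPair a b F = ∀ i j → F (partner a (F i j) i) (partner b (F i j) j) ≢ F i j

ConstantRows : {A B : Set} → (A → B → Color) → Set
ConstantRows F = ∀ i → ∃ λ c → ∀ j → F i j ≡ c

ConstantColumns : {A B : Set} → (A → B → Color) → Set
ConstantColumns F = ∀ j → ∃ λ c → ∀ i → F i j ≡ c

module _ {k l} {a : Fin (suc k) → Color} {b : Fin (suc l) → Color}
         (a-alt : Alternating a) (b-alt : Alternating b)
         (F : Fin (suc k) → Fin (suc l) → Color) (no-good : NoGoodPair a b F) where

  private
    Cell : Set
    Cell = Fin (suc k) × Fin (suc l)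

    next : Cell → Cell
    next (i , j) = partner a (F i j) i , partner b (F i j) j

    τ κ σ : Cell → Color
    τ (i , j) = F i j ⊕ b j
    κ (i , j) = a i ⊕ b j
    σ (i , j) = a i ⊕ F i j

    F-flips : ∀ i j → F (partner a (F i j) i) (partner b (F i j) j) ≡ neg (F i j)
    F-flips i j = ≢⇒≡neg (no-good i j)

    τ-invariant : ∀ p → τ (next p) ≡ τ p
    τ-invariant (i , j) =
      trans (cong₂ _⊕_ (F-flips i j) (alternating-move b-alt (b j ⊕ F i j) j)) (neg-⊕-neg (F i j) (b j))

    κ-invariant : ∀ p → κ (next p) ≡ κ p
    κ-invariant (i , j) =
      trans (cong₂ _⊕_ (alternating-move a-alt (a i ⊕ F i j) i) (alternating-move b-alt (b j ⊕ F i j) j))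
            (neg-⊕-neg (a i) (b j))

    σ-invariant : ∀ p → σ (next p) ≡ σ p
    σ-invariant (i , j) =
      trans (cong₂ _⊕_ (alternating-move a-alt (a i ⊕ F i j) i) (F-flips i j)) (neg-⊕-neg (a i) (F i j))

    proj₁-iterate-next : ∀ p t → proj₁ (iterate next p t) ≡ iterate (move (σ p)) (proj₁ p) t
    proj₁-iterate-next p zero    = refl
    proj₁-iterate-next p (suc t) = trans (proj₁-iterate-next (next p) t)
      (cong (λ s → iterate (move s) (proj₁ (next p)) t) (σ-invariant p))

    row-zero-representative : ∀ p → ∃ λ r → τ (zero , r) ≡ τ p × κ (zero , r) ≡ κ p
    row-zero-representative p with iterate-move-reaches (σ p) (proj₁ p) zero
    ... | t , arrives = proj₂ q , along τ τ-invariant , along κ κ-invariant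
      where
        q : Cell
        q = iterate next p t
        along : (h : Cell → Color) → (∀ p → h (next p) ≡ h p) → h (zero , proj₂ q) ≡ h p
        along h inv = trans (cong (λ i → h (i , proj₂ q)) (sym (trans (proj₁-iterate-next p t) arrives)))
                            (iterate-preserves h inv p t)

    F≡τ⊕b : ∀ i j → F i j ≡ τ (i , j) ⊕ b j
    F≡τ⊕b i j = sym (⊕-cancelʳ (F i j) (b j))

    module NoColourSwitch (none : ∀ r → ¬ (τ (zero , r) ≡ blue × τ (zero , csuc (csuc r)) ≡ red)) where

      blue-spreads : ∀ r r' → b r ≡ b r' → τ (zero , r) ≡ blue → τ (zero , r') ≡ blue
      blue-spreads = two-step-closed⇒colour-closed b-alt (λ r → τ (zero , r) ≡ blue)
        λ r blue₀ → ≢⇒≡neg λ red₂ → none r (blue₀ , red₂)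

      τ₀-colour-determined : ∀ r r' → b r ≡ b r' → τ (zero , r) ≡ τ (zero , r')
      τ₀-colour-determined r r' br with τ (zero , r) in e | τ (zero , r') in e'
      ... | red  | red  = refl
      ... | blue | blue = refl
      ... | red  | blue = trans (sym e) (blue-spreads r' r (sym br) e')
      ... | blue | red  = trans (sym (blue-spreads r r' br e)) e'

      classColour : Color → Color
      classColour c = τ (zero , proj₁ (alternating-onto b-alt (a zero ⊕ c)))

      τ-factors : ∀ p → τ p ≡ classColour (κ p)
      τ-factors p with row-zero-representative p
      ... | r , τ-same , κ-same = trans (sym τ-same) (τ₀-colour-determined r _ (begin
        b r                     ≡⟨ ⊕-cancelˡ (a zero) (b r) ⟨
        a zero ⊕ (a zero ⊕ b r) ≡⟨ cong (a zero ⊕_) κ-same ⟩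
        a zero ⊕ κ p            ≡⟨ proj₂ (alternating-onto b-alt _) ⟨
        _                       ∎))
        where open ≡-Reasoning

      rows-or-columns-constant : ConstantRows F ⊎ ConstantColumns F
      rows-or-columns-constant with Color-function-cases classColour
      ... | inj₁ const  = inj₂ λ j → classColour red ⊕ b j , λ i →
        trans (F≡τ⊕b i j) (cong (_⊕ b j) (trans (τ-factors (i , j)) (const _)))
      ... | inj₂ affine = inj₁ λ i → classColour red ⊕ a i , λ j → begin
        F i j                                     ≡⟨ F≡τ⊕b i j ⟩
        τ (i , j) ⊕ b j                           ≡⟨ cong (_⊕ b j) (trans (τ-factors (i , j)) (affine _)) ⟩
        classColour red ⊕ (a i ⊕ b j) ⊕ b j       ≡⟨ cong (_⊕ b j) (⊕-assoc (classColour red) (a i) (b j)) ⟨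
        classColour red ⊕ a i ⊕ b j ⊕ b j         ≡⟨ ⊕-cancelʳ _ (b j) ⟩
        classColour red ⊕ a i                     ∎
        where open ≡-Reasoning

  row-zero-colour-switch : ¬ ConstantRows F → ¬ ConstantColumns F →
    ∃ λ r → F zero r ≡ neg (b r) × F zero (csuc (csuc r)) ≡ b r
  row-zero-colour-switch rows cols
    with any? (λ r → (τ (zero , r) ≟ᶜ blue) ×-dec (τ (zero , csuc (csuc r)) ≟ᶜ red))
  ... | yes (r , blue₀ , red₂) =
    r , ⊕≡blue⇒≡neg blue₀ , trans (⊕≡red⇒≡ red₂) (alternating-two-step b-alt r)
  ... | no none = ⊥-elim ([ rows , cols ]′ (NoColourSwitch.rows-or-columns-constant λ r → none ∘ (r ,_)))

module _ {W : Set} (H : ColoredGraph W) where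

  edge⇒≢ : ∀ {u v c} → edge H u v ≡ just c → u ≢ v
  edge⇒≢ {u} e refl with trans (sym e) (noLoop H u)
  ... | ()

  alternating-square : ∀ {p q₀ q₁ q₂} c → p ≢ q₀ → p ≢ q₁ → p ≢ q₂ →
    edge H p q₀ ≡ just (neg c) → edge H q₀ q₁ ≡ just c →
    edge H q₁ q₂ ≡ just (neg c) → edge H q₂ p ≡ just c → Alt4Cycle H p q₀ q₁ q₂
  alternating-square {p} {q₀} c p≢q₀ p≢q₁ p≢q₂ e₀ e₁ e₂ e₃ =
    (p≢q₀ , p≢q₁ , p≢q₂ , edge⇒≢ e₁ , q₀≢q₂ , edge⇒≢ e₂) ,
    neg c , c , neg c , c , e₀ , e₁ , e₂ , e₃ ,
    neg-irreflexive c , neg-irreflexive c ∘ sym , neg-irreflexive c , neg-irreflexive c ∘ sym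
    where
      q₀≢q₂ : q₀ ≢ _
      q₀≢q₂ refl = neg-irreflexive c (just-injective (trans (sym e₀) (trans (ColoredGraph.sym H p q₀) e₃)))

  alternating-square-at-switch : ∀ {l} (p : W) (z : Fin (suc l) → W) {b f : Fin (suc l) → Color} →
    (∀ j → edge H (z j) (z (csuc j)) ≡ just (b j)) → Alternating b → (∀ j → p ≢ z j) →
    (∀ j → edge H p (z j) ≡ just (f j)) →
    (∃ λ r → f r ≡ neg (b r) × f (csuc (csuc r)) ≡ b r) →
    ∃ λ r → Alt4Cycle H p (z r) (z (csuc r)) (z (csuc (csuc r)))
  alternating-square-at-switch p z {b} cycle b-alt p∉z spoke (r , fᵣ , fᵣ₊₂) =
    r , alternating-square (b r) (p∉z _) (p∉z _) (p∉z _)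
      (trans (spoke r) (cong just fᵣ)) (cycle r) (trans (cycle (csuc r)) (cong just (b-alt r)))
      (trans (ColoredGraph.sym H _ p) (trans (spoke _) (cong just fᵣ₊₂)))

  partner-isPartner : ∀ {k} (z : Fin (suc k) → W) {a : Fin (suc k) → Color} →
    (∀ i → edge H (z i) (z (csuc i)) ≡ just (a i)) → Alternating a →
    ∀ c i → Partner H z c i (partner a c i)
  partner-isPartner z {a} cycle a-alt c i = at (a i ⊕ c) refl
    where
      at : ∀ s → a i ⊕ c ≡ s → Partner H z c i (move s i)
      at red  e = inj₁ (refl , trans (cycle i) (cong just (⊕≡red⇒≡ e)))
      at blue e = inj₂ (sym (csuc-cpred i) ,
        subst (λ w → edge H (z (cpred i)) (z w) ≡ just c) (csuc-cpred i)
          (trans (cycle (cpred i)) (cong just (begin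
            a (cpred i)   ≡⟨ alternating-cpred a-alt i ⟩
            neg (a i)     ≡⟨ cong neg (⊕≡blue⇒≡neg e) ⟩
            neg (neg c)   ≡⟨ neg-involutive c ⟩
            c             ∎))))
        where open ≡-Reasoning

  nonSingular⇒¬singular : ∀ {S : Set} {emb : S → W} {v} c → NonSingular H emb v → ¬ ColorSingular H emb c v
  nonSingular⇒¬singular red  ns = proj₁ ns
  nonSingular⇒¬singular blue ns = proj₂ ns

  singular-via-surjection : ∀ {S T : Set} (emb : S → W) {z : T → S} → Surjective _≡_ _≡_ z →
    ∀ v c → (∀ t → edge H v (emb (z t)) ≡ just c) → ColorSingular H emb c v
  singular-via-surjection emb onto v c h u with onto u
  ... | t , z≡u = subst (λ w → edge H v (emb w) ≡ just c) (z≡u refl) (h t)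

module _ {W : Set} {H : ColoredGraph W} {n : ℕ} {z : Fin (2 * n) → W} (C : HamAltCycle H n z) where

  cycleColour : Fin (2 * n) → Color
  cycleColour i = proj₁ (HamAltCycle.isEdge C i)

  cycleColour-edge : ∀ i → edge H (z i) (z (csuc i)) ≡ just (cycleColour i)
  cycleColour-edge i = proj₂ (HamAltCycle.isEdge C i)

  cycleColour-alternates : Alternating cycleColour
  cycleColour-alternates i = ≢⇒≡neg λ eq →
    HamAltCycle.alternating C i _ _ (cycleColour-edge i) (cycleColour-edge (csuc i)) (sym eq)

module _ {V₁ V₂ : Set} {G₁ : ColoredGraph V₁} {G₂ : ColoredGraph V₂} {n m : ℕ}
         {x : Fin (2 * suc n) → V₁} {y : Fin (2 * suc m) → V₂}
         (C₁ : HamAltCycle G₁ (suc n) x) (C₂ : HamAltCycle G₂ (suc m) y)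
         {G : ColoredGraph (V₁ ⊎ V₂)} (S : InSum G₁ G₂ G) where

  exteriorColour : Fin (2 * suc n) → Fin (2 * suc m) → Color
  exteriorColour i j = proj₁ (InSum.exterior S (x i) (y j))

  exterior-edge : ∀ i j → edge G (inj₁ (x i)) (inj₂ (y j)) ≡ just (exteriorColour i j)
  exterior-edge i j = proj₂ (InSum.exterior S (x i) (y j))

  left-edge : ∀ i → edge G (inj₁ (x i)) (inj₁ (x (csuc i))) ≡ just (cycleColour C₁ i)
  left-edge i = trans (InSum.left S _ _) (cycleColour-edge C₁ i)

  right-edge : ∀ j → edge G (inj₂ (y j)) (inj₂ (y (csuc j))) ≡ just (cycleColour C₂ j)
  right-edge j = trans (InSum.right S _ _) (cycleColour-edge C₂ j)

  noGoodPair : ¬ HasGoodPair G x y → NoGoodPair (cycleColour C₁) (cycleColour C₂) exteriorColour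
  noGoodPair no-good i j eq = no-good (exteriorColour i j , i , j , _ , _ , exterior-edge i j ,
    partner-isPartner G (inj₁ ∘ x) left-edge (cycleColour-alternates C₁) _ i ,
    partner-isPartner G (inj₂ ∘ y) right-edge (cycleColour-alternates C₂) _ j ,
    trans (exterior-edge _ _) (cong just eq))

  rows-nonconstant : (∃ λ i → NonSingular G inj₂ (inj₁ (x i))) → ¬ ConstantRows exteriorColour
  rows-nonconstant (i , ns) rows with rows i
  ... | c , row = nonSingular⇒¬singular G c ns
    (singular-via-surjection G inj₂ (proj₂ (HamAltCycle.bij C₂)) _ c λ j →
      trans (exterior-edge i j) (cong just (row j)))

  columns-nonconstant : (∃ λ j → NonSingular G inj₁ (inj₂ (y j))) → ¬ ConstantColumns exteriorColour
  columns-nonconstant (j , ns) columns with columns j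
  ... | c , column = nonSingular⇒¬singular G c ns
    (singular-via-surjection G inj₁ (proj₂ (HamAltCycle.bij C₁)) _ c λ i →
      trans (ColoredGraph.sym G _ _) (trans (exterior-edge i j) (cong just (column i))))

mainTheorem5 : {V₁ V₂ : Set} (G₁ : ColoredGraph V₁) (G₂ : ColoredGraph V₂)
    (n m : ℕ) (x : Fin (2 * n) → V₁) (y : Fin (2 * m) → V₂)
    (C₁ : HamAltCycle G₁ n x) (C₂ : HamAltCycle G₂ m y)
    (G : ColoredGraph (V₁ ⊎ V₂)) → InSum G₁ G₂ G →
    ¬ HasGoodPair G x y →
    (∃ λ i → NonSingular G inj₂ (inj₁ (x i))) →
    (∃ λ j → NonSingular G inj₁ (inj₂ (y j))) →
    (∃ λ r → Alt4Cycle G (inj₁ (x (origin n (HamAltCycle.len C₁))))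
        (inj₂ (y r)) (inj₂ (y (csuc r))) (inj₂ (y (csuc (csuc r))))) ×
    (∃ λ s → Alt4Cycle G (inj₂ (y (origin m (HamAltCycle.len C₂))))
        (inj₁ (x s)) (inj₁ (x (csuc s))) (inj₁ (x (csuc (csuc s)))))
mainTheorem5 _ _ zero    _       _ _ C₁ _  _ _ _ _ _ = ⊥-elim (n≮0 (HamAltCycle.len C₁))
mainTheorem5 _ _ (suc _) zero    _ _ _  C₂ _ _ _ _ _ = ⊥-elim (n≮0 (HamAltCycle.len C₂))
mainTheorem5 _ _ (suc _) (suc _) x y C₁ C₂ G S no-good x-nonsingular y-nonsingular =
  alternating-square-at-switch G (inj₁ (x zero)) (inj₂ ∘ y) (right-edge C₁ C₂ S) b-alt (λ _ ())
    (exterior-edge C₁ C₂ S zero)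
    (row-zero-colour-switch a-alt b-alt F noGood rows columns) ,
  alternating-square-at-switch G (inj₂ (y zero)) (inj₁ ∘ x) (left-edge C₁ C₂ S) a-alt (λ _ ())
    (λ i → trans (ColoredGraph.sym G _ _) (exterior-edge C₁ C₂ S i zero))
    (row-zero-colour-switch b-alt a-alt (flip F) (flip noGood) columns rows)
  where
    F = exteriorColour C₁ C₂ S
    a-alt = cycleColour-alternates C₁
    b-alt = cycleColour-alternates C₂
    noGood = noGoodPair C₁ C₂ S no-good
    rows = rows-nonconstant C₁ C₂ S x-nonsingular
    columns = columns-nonconstant C₁ C₂ S y-nonsingular
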